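{- For every positive integer $\nu$ and every integer $q\in\{0,1,\dots,\nu\}$, there exist connected graphs $G_1,G_2$ with $\nu(G_1)=\nu(G_2)=\nu$ such that $I(G_1;-1)\in\{2^q,-2^q\}$ and $I(G_2;-1)\in\{2^q-1,-(2^q-1)\}$.
   Context: A stable set is a set of pairwise non-adjacent vertices; if $s_k$ is the number of stable sets of size $k$ (with $s_0=1$), $I(G;x)=\sum_ks_kx^k$ is the independence polynomial. The cyclomatic number is $\nu(G)=|E(G)|-|V(G)|+p$, with $p$ the number of connected components. -}

module Defs where

open import Data.Nat using (ℕ; zero; suc; _≤_; _<_)
open import Data.Nat.Properties using (_≟_)
open import Data.Bool using (Bool; true; false; _∧_; if_then_else_)
open import Data.Fin using (Fin; toℕ)
open import Data.Fin.Subset using (Subset; _∈_; ∣_∣)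
open import Data.Vec using (Vec; []; _∷_)
import Data.Bool.ListAction
open import Data.List using (List; []; _∷_; map; _++_; filterᵇ; length; sum; allFin; upTo; cartesianProduct)
open import Data.Integer as ℤ using (ℤ; +_; -_)
open import Relation.Binary.PropositionalEquality using (_≡_)
open import Relation.Nullary.Decidable using (does)

record Graph (n : ℕ) : Set where
  field
    adj    : Fin n → Fin n → Bool
    sym    : ∀ i j → adj i j ≡ adj j i
    irrefl : ∀ i → adj i i ≡ false
open Graph public

subsets : (n : ℕ) → List (Subset n)
subsets zero    = [] ∷ []
subsets (suc n) = map (false ∷_) (subsets n) ++ map (true ∷_) (subsets n)

mem : ∀ {n} → Fin n → Subset n → Bool
mem Fin.zero    (b ∷ _) = b
mem (Fin.suc i) (_ ∷ p) = mem i p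

isStable : ∀ {n} → Graph n → Subset n → Bool
isStable {n} G S =
  Data.Bool.ListAction.and (map (λ ij → if mem (Data.Product.proj₁ ij) S ∧ mem (Data.Product.proj₂ ij) S
                              then Data.Bool.not (adj G (Data.Product.proj₁ ij) (Data.Product.proj₂ ij))
                              else true)
                     (cartesianProduct (allFin n) (allFin n)))
  where import Data.Product

stableCount : ∀ {n} → Graph n → ℕ → ℕ
stableCount {n} G k =
  length (filterᵇ (λ S → isStable G S ∧ does (∣ S ∣ ≟ k)) (subsets n)) 
  where open Data.Bool using (_∧_)

indepPoly : ∀ {n} → Graph n → ℤ → ℤ
indepPoly {n} G x = Data.List.foldr ℤ._+_ (+ 0)
  (map (λ k → (+ stableCount G k) ℤ.* (x ℤ.^ k)) (upTo (suc n)))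

edgeCount : ∀ {n} → Graph n → ℕ
edgeCount {n} G = length (filterᵇ (λ ij →
    does (Data.Nat._<?_ (toℕ (Data.Product.proj₁ ij)) (toℕ (Data.Product.proj₂ ij)))
    ∧ adj G (Data.Product.proj₁ ij) (Data.Product.proj₂ ij))
  (cartesianProduct (allFin n) (allFin n)))
  where import Data.Product

data Walk {n} (G : Graph n) : Fin n → Fin n → Set where
  here : ∀ {u} → Walk G u u
  step : ∀ {u v w} → adj G u v ≡ true → Walk G v w → Walk G u w

Connected : ∀ {n} → Graph n → Set
Connected {n} G = (1 ≤ n) Data.Product.× (∀ u v → Walk G u v)
  where import Data.Product

-- Cyclomatic number ν(G) = |E| - |V| + p for a connected graph (p = 1).
cyclomaticConnected : ∀ {n} → Graph n → ℤ
cyclomaticConnected {n} G = (+ edgeCount G) ℤ.- (+ n) ℤ.+ (+ 1)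

-- Hang triangles, 4-cycles and pendant edges by their roots from a hub vertex h. Deleting h,
-- I(G; -1) = I(G − h; -1) − I(G − N[h]; -1), and both terms are products over the gadgets, which
-- are disjoint once h is gone. The factors are I(K₃) = −2 and I(K₂) = −1 for a triangle,
-- I(C₄) = I(P₃) = −1 for a square, I(K₂) = −1 and I(K₁) = 0 for a pendant edge. So q triangles and
-- ν − q squares give ±(2^q − 1), adding one pendant edge gives ±2^q, and the cyclomatic number
-- counts the triangles and squares.
module Submission where

open import Defs
open import Data.Nat using (ℕ; _≤_; _^_; _∸_)
open import Data.Integer using (ℤ; +_; -_)
open import Data.Product using (Σ; _×_; _,_)
open import Data.Sum using (_⊎_)
open import Relation.Binary.PropositionalEquality using (_≡_)

open import Data.Product using (proj₁; proj₂)
open import Data.Bool using (Bool; true; false; _∧_; not; if_then_else_; T)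
open import Data.Bool.Properties using (∧-assoc; ∧-zeroʳ; ⇔→≡; T-≡; T-∧)
open import Data.Fin as Fin using (Fin; zero; suc; toℕ)
open import Data.Vec as Vec using ([]; _∷_)
open import Data.Fin.Subset using (Subset; ⊥; _∪_; ∣_∣)
open import Data.Fin.Subset.Properties using (∣p∣≤n; ∣⊥∣≡0; ∪-identityʳ; ∪-identityˡ)
open import Data.Integer as ℤ using (0ℤ; 1ℤ; -1ℤ; _+_; _*_; _-_)
import Data.Integer.Properties as ℤ
open import Data.Integer.Tactic.RingSolver using (solve-∀)
open import Data.List using (List; []; _∷_; map; _++_; foldr; filterᵇ; length; upTo; allFin; tabulate; cartesianProduct; replicate)
open import Data.List.Properties using (map-applyUpTo; map-∘; map-tabulate; tabulate-cong; filter-++; length-++)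
open import Data.Nat.ListAction using (sum)
open import Data.Nat as ℕ using (zero; suc; _<_; z≤n; s≤s)
import Data.Nat.Properties as ℕ
import Data.Nat.Tactic.RingSolver as ℕ-Solver
open import Data.Sum as Sum using (inj₁; inj₂)
open import Function using (_∘_; id; mk⇔; Equivalence)
open import Data.List.Relation.Unary.All as All using (All)
open import Data.List.Relation.Unary.All.Properties using (all⁺; all⁻)
open import Data.List.Membership.Propositional.Properties using (∈-allFin; ∈-cartesianProduct⁺)
open import Relation.Binary.PropositionalEquality using (refl; trans; cong; cong₂; module ≡-Reasoning) renaming (sym to ≡-sym)
open import Relation.Nullary using (does)
open import Relation.Nullary.Decidable using (T?)

∑ : {A : Set} → List A → (A → ℤ) → ℤ
∑ xs h = foldr _+_ 0ℤ (map h xs)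

module _ {A : Set} where

  ∑-cong : (xs : List A) {h h′ : A → ℤ} → (∀ a → h a ≡ h′ a) → ∑ xs h ≡ ∑ xs h′
  ∑-cong []       eq = refl
  ∑-cong (a ∷ xs) eq = cong₂ _+_ (eq a) (∑-cong xs eq)

  ∑-zero : (xs : List A) → ∑ xs (λ _ → 0ℤ) ≡ 0ℤ
  ∑-zero []       = refl
  ∑-zero (a ∷ xs) = trans (ℤ.+-identityˡ _) (∑-zero xs)

  ∑-++ : (xs ys : List A) (h : A → ℤ) → ∑ (xs ++ ys) h ≡ ∑ xs h + ∑ ys h
  ∑-++ []       ys h = ≡-sym (ℤ.+-identityˡ (∑ ys h))
  ∑-++ (a ∷ xs) ys h =
    trans (cong (_+_ (h a)) (∑-++ xs ys h)) (≡-sym (ℤ.+-assoc (h a) (∑ xs h) (∑ ys h)))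

  ∑-+ : (xs : List A) (h h′ : A → ℤ) → ∑ xs (λ a → h a + h′ a) ≡ ∑ xs h + ∑ xs h′
  ∑-+ []       h h′ = refl
  ∑-+ (a ∷ xs) h h′ =
    trans (cong (_+_ (h a + h′ a)) (∑-+ xs h h′)) (swap (h a) (h′ a) (∑ xs h) (∑ xs h′))
    where
    swap : ∀ a b c d → a + b + (c + d) ≡ a + c + (b + d)
    swap = solve-∀

  ∑-*ˡ : (x : ℤ) (xs : List A) (h : A → ℤ) → ∑ xs (λ a → x * h a) ≡ x * ∑ xs h
  ∑-*ˡ x []       h = ≡-sym (ℤ.*-zeroʳ x)
  ∑-*ˡ x (a ∷ xs) h =
    trans (cong (_+_ (x * h a)) (∑-*ˡ x xs h)) (≡-sym (ℤ.*-distribˡ-+ x (h a) (∑ xs h)))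

  ∑-map : {B : Set} (f : B → A) (xs : List B) (h : A → ℤ) → ∑ (map f xs) h ≡ ∑ xs (h ∘ f)
  ∑-map f xs h = cong (foldr _+_ 0ℤ) (≡-sym (map-∘ xs))

∏ : {A : Set} → List A → (A → ℤ) → ℤ
∏ xs h = foldr _*_ 1ℤ (map h xs)

module _ {A : Set} where

  ∏-++ : (xs ys : List A) (h : A → ℤ) → ∏ (xs ++ ys) h ≡ ∏ xs h * ∏ ys h
  ∏-++ []       ys h = ≡-sym (ℤ.*-identityˡ (∏ ys h))
  ∏-++ (a ∷ xs) ys h = trans (cong (h a *_) (∏-++ xs ys h)) (≡-sym (ℤ.*-assoc (h a) (∏ xs h) (∏ ys h)))

  ∏-replicate : (k : ℕ) (a : A) (h : A → ℤ) → ∏ (replicate k a) h ≡ h a ℤ.^ k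
  ∏-replicate zero    a h = refl
  ∏-replicate (suc k) a h = cong (h a *_) (∏-replicate k a h)

∑-upTo-suc : (m : ℕ) (h : ℕ → ℤ) → ∑ (upTo (suc m)) h ≡ h 0 + ∑ (upTo m) (h ∘ suc)
∑-upTo-suc m h =
  cong (_+_ (h 0)) (trans (cong (λ ks → ∑ ks h) (≡-sym (map-applyUpTo id suc m))) (∑-map suc (upTo m) h))

∑-upTo-indicator : (m t : ℕ) (h : ℕ → ℤ) → t < m →
  ∑ (upTo m) (λ k → if does (t ℕ.≟ k) then h k else 0ℤ) ≡ h t
∑-upTo-indicator (suc m) zero    h _ = begin
  ∑ (upTo (suc m)) δ           ≡⟨ ∑-upTo-suc m δ ⟩
  h 0 + ∑ (upTo m) (λ _ → 0ℤ) ≡⟨ cong (_+_ (h 0)) (∑-zero (upTo m)) ⟩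
  h 0 + 0ℤ                     ≡⟨ ℤ.+-identityʳ (h 0) ⟩
  h 0                          ∎
  where
  open ≡-Reasoning
  δ : ℕ → ℤ
  δ k = if does (0 ℕ.≟ k) then h k else 0ℤ
∑-upTo-indicator (suc m) (suc t) h (s≤s t<m) =
  trans (∑-upTo-suc m (λ k → if does (suc t ℕ.≟ k) then h k else 0ℤ))
        (trans (ℤ.+-identityˡ _) (∑-upTo-indicator m t (h ∘ suc) t<m))

count : {A : Set} → (A → Bool) → List A → ℕ
count p xs = length (filterᵇ p xs)

count-++ : {A : Set} (p : A → Bool) (xs ys : List A) → count p (xs ++ ys) ≡ count p xs ℕ.+ count p ys
count-++ p xs ys = trans (cong length (filter-++ (T? ∘ p) xs ys)) (length-++ (filterᵇ p xs))

count-map : {A B : Set} (p : A → Bool) (f : B → A) (xs : List B) → count p (map f xs) ≡ count (p ∘ f) xs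
count-map p f []       = refl
count-map p f (x ∷ xs) with p (f x)
... | true  = cong suc (count-map p f xs)
... | false = count-map p f xs

count-tabulate : {A : Set} {n : ℕ} (p : A → Bool) (f : Fin n → A) →
  count p (tabulate f) ≡ count (p ∘ f) (allFin n)
count-tabulate p f = trans (cong (count p) (≡-sym (map-tabulate id f))) (count-map p f (allFin _))

count-cartesianProduct : {A B : Set} (p : A × B → Bool) (xs : List A) (ys : List B) →
  count p (cartesianProduct xs ys) ≡ sum (map (λ x → count (λ y → p (x , y)) ys) xs)
count-cartesianProduct p []       ys = refl
count-cartesianProduct p (x ∷ xs) ys = begin
  count p (map (x ,_) ys ++ cartesianProduct xs ys)
    ≡⟨ count-++ p (map (x ,_) ys) (cartesianProduct xs ys) ⟩
  count p (map (x ,_) ys) ℕ.+ count p (cartesianProduct xs ys)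
    ≡⟨ cong₂ ℕ._+_ (count-map p (x ,_) ys) (count-cartesianProduct p xs ys) ⟩
  count (λ y → p (x , y)) ys ℕ.+ sum (map (λ x → count (λ y → p (x , y)) ys) xs)
    ∎
  where open ≡-Reasoning

module _ {A : Set} where

  count-∷-* : (p : A → Bool) (a : A) (xs : List A) (y : ℤ) →
    + count p (a ∷ xs) * y ≡ (if p a then y else 0ℤ) + + count p xs * y
  count-∷-* p a xs y with p a
  ... | true  = trans (ℤ.*-distribʳ-+ y (+ 1) (+ count p xs)) (cong (_+ + count p xs * y) (ℤ.*-identityˡ y))
  ... | false = ≡-sym (ℤ.+-identityˡ _)

  ∑-count-by-size : (p : A → Bool) (size : A → ℕ) (x : ℤ) (m : ℕ) →
    (∀ a → size a < m) → (xs : List A) →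
    ∑ (upTo m) (λ k → + count (λ a → p a ∧ does (size a ℕ.≟ k)) xs * x ℤ.^ k)
      ≡ ∑ xs (λ a → if p a then x ℤ.^ size a else 0ℤ)
  ∑-count-by-size p size x m bounded []       = ∑-zero (upTo m)
  ∑-count-by-size p size x m bounded (a ∷ xs) = begin
    ∑ (upTo m) (λ k → + count (hit k) (a ∷ xs) * x ℤ.^ k)
      ≡⟨ ∑-cong (upTo m) (λ k → count-∷-* (hit k) a xs (x ℤ.^ k)) ⟩
    ∑ (upTo m) (λ k → (if hit k a then x ℤ.^ k else 0ℤ) + + count (hit k) xs * x ℤ.^ k)
      ≡⟨ ∑-+ (upTo m) _ _ ⟩
    ∑ (upTo m) (λ k → if hit k a then x ℤ.^ k else 0ℤ)
      + ∑ (upTo m) (λ k → + count (hit k) xs * x ℤ.^ k)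
      ≡⟨ cong₂ _+_ weight-of-a (∑-count-by-size p size x m bounded xs) ⟩
    (if p a then x ℤ.^ size a else 0ℤ) + ∑ xs (λ a → if p a then x ℤ.^ size a else 0ℤ)
      ∎
    where
    open ≡-Reasoning
    hit : ℕ → A → Bool
    hit k a = p a ∧ does (size a ℕ.≟ k)
    weight-of-a : ∑ (upTo m) (λ k → if hit k a then x ℤ.^ k else 0ℤ)
                  ≡ (if p a then x ℤ.^ size a else 0ℤ)
    weight-of-a with p a
    ... | true  = ∑-upTo-indicator m (size a) (x ℤ.^_) (bounded a)
    ... | false = ∑-zero (upTo m)

indepPoly-≡-∑-stable : ∀ {n} (G : Graph n) (x : ℤ) →
  indepPoly G x ≡ ∑ (subsets n) (λ S → if isStable G S then x ℤ.^ ∣ S ∣ else 0ℤ)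
indepPoly-≡-∑-stable {n} G x =
  ∑-count-by-size (isStable G) ∣_∣ x (suc n) (λ S → s≤s (∣p∣≤n S)) (subsets n)

if-∧-sound : ∀ {b c x} → T (if b ∧ c then x else true) → T b → T c → T x
if-∧-sound {true} {true} ok _ _ = ok

if-∧-complete : ∀ {b c x} → (T b → T c → T x) → T (if b ∧ c then x else true)
if-∧-complete {false}        _  = _
if-∧-complete {true} {false} _  = _
if-∧-complete {true} {true}  ok = ok _ _

T-ext : ∀ {x y} → (T x → T y) → (T y → T x) → x ≡ y
T-ext to from = ⇔→≡ (mk⇔ (lift to) (lift from))
  where
  lift : ∀ {x y} → (T x → T y) → x ≡ true → y ≡ true
  lift f = Equivalence.to T-≡ ∘ f ∘ Equivalence.from T-≡

if-*ʳ : ∀ b (x y : ℤ) → (if b then x * y else 0ℤ) ≡ x * (if b then y else 0ℤ)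
if-*ʳ true  x y = refl
if-*ʳ false x y = ≡-sym (ℤ.*-zeroʳ x)

Independent : ∀ {n} → (Fin n → Fin n → Bool) → Subset n → Set
Independent a S = ∀ i j → T (mem i S) → T (mem j S) → T (not (a i j))

module _ {n} (G : Graph n) (S : Subset n) where

  private
    nonEdge : Fin n × Fin n → Bool
    nonEdge (i , j) = if mem i S ∧ mem j S then not (adj G i j) else true

  isStable-sound : T (isStable G S) → Independent (adj G) S
  isStable-sound stable i j =
    if-∧-sound (All.lookup (all⁺ nonEdge _ stable) (∈-cartesianProduct⁺ (∈-allFin i) (∈-allFin j)))

  isStable-complete : Independent (adj G) S → T (isStable G S)
  isStable-complete independent =
    all⁻ nonEdge {cartesianProduct (allFin n) (allFin n)}
         (All.tabulate λ {(i , j)} _ → if-∧-complete (independent i j))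

_++ʷ_ : ∀ {n} {G : Graph n} {u v w} → Walk G u v → Walk G v w → Walk G u w
here      ++ʷ q = q
step uv p ++ʷ q = step uv (p ++ʷ q)

reverseʷ : ∀ {n} {G : Graph n} {u v} → Walk G u v → Walk G v u
reverseʷ             here                = here
reverseʷ {G = G} (step {u} {v} uv p) = reverseʷ p ++ʷ step (trans (Graph.sym G v u) uv) here

-- A graph grown vertex by vertex: grow r g adds a new vertex 0 adjacent to the vertices r of g.
data Built : ℕ → Set where
  empty : Built 0
  grow  : ∀ {n} → Subset n → Built n → Built (suc n)

adjacency : ∀ {n} → Built n → Fin n → Fin n → Bool
adjacency (grow r g) zero    zero    = false
adjacency (grow r g) zero    (suc j) = mem j r
adjacency (grow r g) (suc i) zero    = mem i r
adjacency (grow r g) (suc i) (suc j) = adjacency g i j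

adjacency-sym : ∀ {n} (g : Built n) i j → adjacency g i j ≡ adjacency g j i
adjacency-sym (grow r g) zero    zero    = refl
adjacency-sym (grow r g) zero    (suc j) = refl
adjacency-sym (grow r g) (suc i) zero    = refl
adjacency-sym (grow r g) (suc i) (suc j) = adjacency-sym g i j

adjacency-irrefl : ∀ {n} (g : Built n) i → adjacency g i i ≡ false
adjacency-irrefl (grow r g) zero    = refl
adjacency-irrefl (grow r g) (suc i) = adjacency-irrefl g i

graph : ∀ {n} → Built n → Graph n
graph g = record { adj = adjacency g ; sym = adjacency-sym g ; irrefl = adjacency-irrefl g }

liftʷ : ∀ {n} {g : Built n} {r : Subset n} {i j} → Walk (graph g) i j → Walk (graph (grow r g)) (suc i) (suc j)
liftʷ here       = here
liftʷ (step e p) = step e (liftʷ p)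

edges : ∀ {n} → Built n → ℕ
edges empty      = 0
edges (grow r g) = ∣ r ∣ ℕ.+ edges g

disjointᵇ : ∀ {n} → Subset n → Subset n → Bool
disjointᵇ []         []         = true
disjointᵇ (true ∷ S) (true ∷ R) = false
disjointᵇ (_ ∷ S)    (_ ∷ R)    = disjointᵇ S R

stableᵇ : ∀ {n} → Built n → Subset n → Bool
stableᵇ empty      []          = true
stableᵇ (grow r g) (false ∷ S) = stableᵇ g S
stableᵇ (grow r g) (true ∷ S)  = disjointᵇ S r ∧ stableᵇ g S

Disjoint : ∀ {n} → Subset n → Subset n → Set
Disjoint S R = ∀ j → T (mem j S) → T (not (mem j R))

disjointᵇ-sound : ∀ {n} (S R : Subset n) → T (disjointᵇ S R) → Disjoint S R
disjointᵇ-sound (true ∷ S)  (false ∷ R) _        zero    _   = _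
disjointᵇ-sound (true ∷ S)  (true ∷ R)  ()       zero    _
disjointᵇ-sound (false ∷ S) (r ∷ R)     disjoint (suc j) j∈S = disjointᵇ-sound S R disjoint j j∈S
disjointᵇ-sound (true ∷ S)  (false ∷ R) disjoint (suc j) j∈S = disjointᵇ-sound S R disjoint j j∈S

disjointᵇ-complete : ∀ {n} (S R : Subset n) → Disjoint S R → T (disjointᵇ S R)
disjointᵇ-complete []          []          _        = _
disjointᵇ-complete (true ∷ S)  (true ∷ R)  disjoint = disjoint zero _
disjointᵇ-complete (true ∷ S)  (false ∷ R) disjoint = disjointᵇ-complete S R (disjoint ∘ suc)
disjointᵇ-complete (false ∷ S) (r ∷ R)     disjoint = disjointᵇ-complete S R (disjoint ∘ suc)

stableᵇ-sound : ∀ {n} (g : Built n) S → T (stableᵇ g S) → Independent (adjacency g) S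
stableᵇ-sound (grow r g) (b ∷ S)     _      zero    zero    _   _   = _
stableᵇ-sound (grow r g) (true ∷ S)  stable zero    (suc j) _   j∈S =
  disjointᵇ-sound S r (proj₁ (Equivalence.to T-∧ stable)) j j∈S
stableᵇ-sound (grow r g) (true ∷ S)  stable (suc i) zero    i∈S _   =
  disjointᵇ-sound S r (proj₁ (Equivalence.to T-∧ stable)) i i∈S
stableᵇ-sound (grow r g) (true ∷ S)  stable (suc i) (suc j) =
  stableᵇ-sound g S (proj₂ (Equivalence.to T-∧ stable)) i j
stableᵇ-sound (grow r g) (false ∷ S) stable (suc i) (suc j) = stableᵇ-sound g S stable i j

stableᵇ-complete : ∀ {n} (g : Built n) S → Independent (adjacency g) S → T (stableᵇ g S)
stableᵇ-complete empty      []          _           = _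
stableᵇ-complete (grow r g) (false ∷ S) independent =
  stableᵇ-complete g S (λ i j → independent (suc i) (suc j))
stableᵇ-complete (grow r g) (true ∷ S)  independent = Equivalence.from T-∧
  ( disjointᵇ-complete S r (λ j → independent zero (suc j) _)
  , stableᵇ-complete g S (λ i j → independent (suc i) (suc j)))

isStable-graph : ∀ {n} (g : Built n) S → isStable (graph g) S ≡ stableᵇ g S
isStable-graph g S = T-ext (stableᵇ-complete g S ∘ isStable-sound (graph g) S)
                           (isStable-complete (graph g) S ∘ stableᵇ-sound g S)

-- indep x g F = I(g − F; x). Deleting the newest vertex v gives I(G) = I(G − v) + x I(G − N[v]).
indep : ∀ {n} → ℤ → Built n → Subset n → ℤ
indep x empty      []          = 1ℤ
indep x (grow r g) (true ∷ F)  = indep x g F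
indep x (grow r g) (false ∷ F) = indep x g F + x * indep x g (F ∪ r)

disjointᵇ-∪ : ∀ {n} (S F R : Subset n) → disjointᵇ S (F ∪ R) ≡ disjointᵇ S F ∧ disjointᵇ S R
disjointᵇ-∪ []          []          []          = refl
disjointᵇ-∪ (false ∷ S) (f ∷ F)     (r ∷ R)     = disjointᵇ-∪ S F R
disjointᵇ-∪ (true ∷ S)  (true ∷ F)  (r ∷ R)     = refl
disjointᵇ-∪ (true ∷ S)  (false ∷ F) (false ∷ R) = disjointᵇ-∪ S F R
disjointᵇ-∪ (true ∷ S)  (false ∷ F) (true ∷ R)  = ≡-sym (∧-zeroʳ (disjointᵇ S F))

disjointᵇ-⊥ : ∀ {n} (S : Subset n) → disjointᵇ S ⊥ ≡ true
disjointᵇ-⊥ []          = refl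
disjointᵇ-⊥ (false ∷ S) = disjointᵇ-⊥ S
disjointᵇ-⊥ (true ∷ S)  = disjointᵇ-⊥ S

∑-stable-disjoint : ∀ {n} (x : ℤ) (g : Built n) (F : Subset n) →
  ∑ (subsets n) (λ S → if disjointᵇ S F ∧ stableᵇ g S then x ℤ.^ ∣ S ∣ else 0ℤ) ≡ indep x g F
∑-stable-disjoint x empty      []      = refl
∑-stable-disjoint {suc n} x (grow r g) (f ∷ F) = begin
  ∑ (map (false ∷_) (subsets n) ++ map (true ∷_) (subsets n)) term
    ≡⟨ ∑-++ (map (false ∷_) (subsets n)) _ term ⟩
  ∑ (map (false ∷_) (subsets n)) term + ∑ (map (true ∷_) (subsets n)) term
    ≡⟨ cong₂ _+_ (∑-map (false ∷_) (subsets n) term) (∑-map (true ∷_) (subsets n) term) ⟩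
  ∑ (subsets n) (term ∘ (false ∷_)) + ∑ (subsets n) (term ∘ (true ∷_))
    ≡⟨ cong₂ _+_ (∑-stable-disjoint x g F) (with-newest f) ⟩
  indep x g F + (if f then 0ℤ else x * indep x g (F ∪ r))
    ≡⟨ recurrence f ⟩
  indep x (grow r g) (f ∷ F)
    ∎
  where
  open ≡-Reasoning
  term : Subset (suc n) → ℤ
  term S = if disjointᵇ S (f ∷ F) ∧ stableᵇ (grow r g) S then x ℤ.^ ∣ S ∣ else 0ℤ
  with-newest : ∀ f → ∑ (subsets n) (λ S → if disjointᵇ (true ∷ S) (f ∷ F) ∧ stableᵇ (grow r g) (true ∷ S)
                                             then x ℤ.^ ∣ true ∷ S ∣ else 0ℤ)
                      ≡ (if f then 0ℤ else x * indep x g (F ∪ r))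
  with-newest true  = ∑-zero (subsets n)
  with-newest false = begin
    ∑ (subsets n) (λ S → if disjointᵇ S F ∧ (disjointᵇ S r ∧ stableᵇ g S) then x * x ℤ.^ ∣ S ∣ else 0ℤ)
      ≡⟨ ∑-cong (subsets n) pointwise ⟩
    ∑ (subsets n) (λ S → x * (if disjointᵇ S (F ∪ r) ∧ stableᵇ g S then x ℤ.^ ∣ S ∣ else 0ℤ))
      ≡⟨ ∑-*ˡ x (subsets n) _ ⟩
    x * ∑ (subsets n) (λ S → if disjointᵇ S (F ∪ r) ∧ stableᵇ g S then x ℤ.^ ∣ S ∣ else 0ℤ)
      ≡⟨ cong (x *_) (∑-stable-disjoint x g (F ∪ r)) ⟩
    x * indep x g (F ∪ r)
      ∎
    where
    pointwise : ∀ S → (if disjointᵇ S F ∧ (disjointᵇ S r ∧ stableᵇ g S) then x * x ℤ.^ ∣ S ∣ else 0ℤ)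
                    ≡ x * (if disjointᵇ S (F ∪ r) ∧ stableᵇ g S then x ℤ.^ ∣ S ∣ else 0ℤ)
    pointwise S rewrite disjointᵇ-∪ S F r | ∧-assoc (disjointᵇ S F) (disjointᵇ S r) (stableᵇ g S) =
      if-*ʳ _ x (x ℤ.^ ∣ S ∣)
  recurrence : ∀ f → indep x g F + (if f then 0ℤ else x * indep x g (F ∪ r)) ≡ indep x (grow r g) (f ∷ F)
  recurrence true  = ℤ.+-identityʳ (indep x g F)
  recurrence false = refl

indepPoly-graph : ∀ {n} (g : Built n) (x : ℤ) → indepPoly (graph g) x ≡ indep x g ⊥
indepPoly-graph {n} g x = begin
  indepPoly (graph g) x
    ≡⟨ indepPoly-≡-∑-stable (graph g) x ⟩
  ∑ (subsets n) (λ S → if isStable (graph g) S then x ℤ.^ ∣ S ∣ else 0ℤ)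
    ≡⟨ ∑-cong (subsets n) pointwise ⟩
  ∑ (subsets n) (λ S → if disjointᵇ S ⊥ ∧ stableᵇ g S then x ℤ.^ ∣ S ∣ else 0ℤ)
    ≡⟨ ∑-stable-disjoint x g ⊥ ⟩
  indep x g ⊥
    ∎
  where
  open ≡-Reasoning
  pointwise : ∀ S → (if isStable (graph g) S then x ℤ.^ ∣ S ∣ else 0ℤ)
                  ≡ (if disjointᵇ S ⊥ ∧ stableᵇ g S then x ℤ.^ ∣ S ∣ else 0ℤ)
  pointwise S rewrite isStable-graph g S | disjointᵇ-⊥ S = refl

count-mem : ∀ {n} (R : Subset n) → count (λ j → mem j R) (allFin n) ≡ ∣ R ∣
count-mem []         = refl
count-mem (true ∷ R)  = cong suc (trans (count-tabulate (λ j → mem j (true ∷ R)) Fin.suc) (count-mem R))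
count-mem (false ∷ R) = trans (count-tabulate (λ j → mem j (false ∷ R)) Fin.suc) (count-mem R)

forwardEdge : ∀ {n} → Built n → Fin n → Fin n → Bool
forwardEdge g i j = does (toℕ i ℕ.<? toℕ j) ∧ adjacency g i j

∑-forward-edges : ∀ {n} (g : Built n) → sum (tabulate (λ i → count (forwardEdge g i) (allFin n))) ≡ edges g
∑-forward-edges empty      = refl
∑-forward-edges {suc n} (grow r g) =
  cong₂ ℕ._+_ (trans (count-tabulate (forwardEdge (grow r g) zero) Fin.suc) (count-mem r))
              (trans (cong sum (tabulate-cong λ i → count-tabulate (forwardEdge (grow r g) (suc i)) Fin.suc))
                     (∑-forward-edges g))

edgeCount-graph : ∀ {n} (g : Built n) → edgeCount (graph g) ≡ edges g
edgeCount-graph {n} g = begin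
  edgeCount (graph g)
    ≡⟨ count-cartesianProduct (λ (i , j) → forwardEdge g i j) (allFin n) (allFin n) ⟩
  sum (map (λ i → count (forwardEdge g i) (allFin n)) (allFin n))
    ≡⟨ cong sum (map-tabulate id (λ i → count (forwardEdge g i) (allFin n))) ⟩
  sum (tabulate (λ i → count (forwardEdge g i) (allFin n)))
    ≡⟨ ∑-forward-edges g ⟩
  edges g
    ∎
  where open ≡-Reasoning

_⊕_ : ∀ {m n} → Built m → Built n → Built (m ℕ.+ n)
empty    ⊕ h = h
grow r g ⊕ h = grow (r Vec.++ ⊥) (g ⊕ h)

++-∪-⊥ : ∀ {m n} (F R : Subset m) (H : Subset n) → (F Vec.++ H) ∪ (R Vec.++ ⊥) ≡ (F ∪ R) Vec.++ H
++-∪-⊥ []      []      H = ∪-identityʳ H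
++-∪-⊥ (f ∷ F) (r ∷ R) H = cong (_ ∷_) (++-∪-⊥ F R H)

indep-⊕ : ∀ {m n} (x : ℤ) (g : Built m) (h : Built n) (F : Subset m) (H : Subset n) →
  indep x (g ⊕ h) (F Vec.++ H) ≡ indep x g F * indep x h H
indep-⊕ x empty      h []          H = ≡-sym (ℤ.*-identityˡ (indep x h H))
indep-⊕ x (grow r g) h (true ∷ F)  H = indep-⊕ x g h F H
indep-⊕ x (grow r g) h (false ∷ F) H = begin
  indep x (g ⊕ h) (F Vec.++ H) + x * indep x (g ⊕ h) ((F Vec.++ H) ∪ (r Vec.++ ⊥))
    ≡⟨ cong (λ K → indep x (g ⊕ h) (F Vec.++ H) + x * indep x (g ⊕ h) K) (++-∪-⊥ F r H) ⟩
  indep x (g ⊕ h) (F Vec.++ H) + x * indep x (g ⊕ h) ((F ∪ r) Vec.++ H)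
    ≡⟨ cong₂ (λ a b → a + x * b) (indep-⊕ x g h F H) (indep-⊕ x g h (F ∪ r) H) ⟩
  indep x g F * indep x h H + x * (indep x g (F ∪ r) * indep x h H)
    ≡⟨ factor x (indep x g F) (indep x g (F ∪ r)) (indep x h H) ⟩
  (indep x g F + x * indep x g (F ∪ r)) * indep x h H
    ∎
  where
  open ≡-Reasoning
  factor : ∀ x a b c → a * c + x * (b * c) ≡ (a + x * b) * c
  factor = solve-∀

⊥-++ : ∀ m {n} → ⊥ {m} Vec.++ ⊥ {n} ≡ ⊥
⊥-++ zero    = refl
⊥-++ (suc m) = cong (false ∷_) (⊥-++ m)

∣++⊥∣ : ∀ {m n} (R : Subset m) → ∣ R Vec.++ ⊥ {n} ∣ ≡ ∣ R ∣
∣++⊥∣ {n = n} []  = ∣⊥∣≡0 n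
∣++⊥∣ (true ∷ R)  = cong suc (∣++⊥∣ R)
∣++⊥∣ (false ∷ R) = ∣++⊥∣ R

edges-⊕ : ∀ {m n} (g : Built m) (h : Built n) → edges (g ⊕ h) ≡ edges g ℕ.+ edges h
edges-⊕ empty      h = refl
edges-⊕ (grow r g) h =
  trans (cong₂ ℕ._+_ (∣++⊥∣ r) (edges-⊕ g h)) (≡-sym (ℕ.+-assoc ∣ r ∣ (edges g) (edges h)))

data Gadget : Set where
  triangle square pendant : Gadget

order : Gadget → ℕ
order triangle = 3
order square   = 4
order pendant  = 2

-- Vertex 0 is the root; the square is the cycle 0 1 2 3.
gadget : (γ : Gadget) → Built (order γ)
gadget triangle = grow (true ∷ true ∷ []) (grow (true ∷ []) (grow [] empty))
gadget square   =
  grow (true ∷ false ∷ true ∷ []) (grow (true ∷ false ∷ []) (grow (true ∷ []) (grow [] empty)))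
gadget pendant  = grow (true ∷ []) (grow [] empty)

root : Bool → (γ : Gadget) → Subset (order γ)
root b triangle = b ∷ ⊥
root b square   = b ∷ ⊥
root b pendant  = b ∷ ⊥

cycles : Gadget → ℕ
cycles triangle = 1
cycles square   = 1
cycles pendant  = 0

-- The suc is the edge from the root to the hub.
gadget-edges : ∀ γ → suc (edges (gadget γ)) ≡ cycles γ ℕ.+ order γ
gadget-edges triangle = refl
gadget-edges square   = refl
gadget-edges pendant  = refl

size : List Gadget → ℕ
size gs = sum (map order gs)

body : (gs : List Gadget) → Built (size gs)
body []       = empty
body (γ ∷ gs) = gadget γ ⊕ body gs

roots : Bool → (gs : List Gadget) → Subset (size gs)
roots b []       = []
roots b (γ ∷ gs) = root b γ Vec.++ roots b gs

hub : (gs : List Gadget) → Built (suc (size gs))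
hub gs = grow (roots true gs) (body gs)

indep-body : (x : ℤ) (b : Bool) (gs : List Gadget) →
  indep x (body gs) (roots b gs) ≡ ∏ gs (λ γ → indep x (gadget γ) (root b γ))
indep-body x b []       = refl
indep-body x b (γ ∷ gs) =
  trans (indep-⊕ x (gadget γ) (body gs) (root b γ) (roots b gs))
        (cong (indep x (gadget γ) (root b γ) *_) (indep-body x b gs))

root-false : ∀ γ → root false γ ≡ ⊥
root-false triangle = refl
root-false square   = refl
root-false pendant  = refl

roots-false : ∀ gs → roots false gs ≡ ⊥
roots-false []       = refl
roots-false (γ ∷ gs) = trans (cong₂ Vec._++_ (root-false γ) (roots-false gs)) (⊥-++ (order γ))

indepPoly-hub : (x : ℤ) (gs : List Gadget) →
  indepPoly (graph (hub gs)) x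
    ≡ ∏ gs (λ γ → indep x (gadget γ) (root false γ))
      + x * ∏ gs (λ γ → indep x (gadget γ) (root true γ))
indepPoly-hub x gs = begin
  indepPoly (graph (hub gs)) x
    ≡⟨ indepPoly-graph (hub gs) x ⟩
  indep x (body gs) ⊥ + x * indep x (body gs) (⊥ ∪ roots true gs)
    ≡⟨ cong₂ (λ F R → indep x (body gs) F + x * indep x (body gs) R)
             (≡-sym (roots-false gs)) (∪-identityˡ _) ⟩
  indep x (body gs) (roots false gs) + x * indep x (body gs) (roots true gs)
    ≡⟨ cong₂ (λ a b → a + x * b) (indep-body x false gs) (indep-body x true gs) ⟩
  ∏ gs (λ γ → indep x (gadget γ) (root false γ)) + x * ∏ gs (λ γ → indep x (gadget γ) (root true γ))
    ∎
  where open ≡-Reasoning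

cycleRank : List Gadget → ℕ
cycleRank gs = sum (map cycles gs)

∣root-true-++∣ : ∀ γ {n} (R : Subset n) → ∣ root true γ Vec.++ R ∣ ≡ suc ∣ R ∣
∣root-true-++∣ triangle R = refl
∣root-true-++∣ square   R = refl
∣root-true-++∣ pendant  R = refl

edges-hub : ∀ gs → edges (hub gs) ≡ cycleRank gs ℕ.+ size gs
edges-hub []       = refl
edges-hub (γ ∷ gs) = begin
  ∣ root true γ Vec.++ roots true gs ∣ ℕ.+ edges (gadget γ ⊕ body gs)
    ≡⟨ cong₂ ℕ._+_ (∣root-true-++∣ γ (roots true gs)) (edges-⊕ (gadget γ) (body gs)) ⟩
  suc ∣ roots true gs ∣ ℕ.+ (edges (gadget γ) ℕ.+ edges (body gs))
    ≡⟨ shuffle ∣ roots true gs ∣ (edges (gadget γ)) (edges (body gs)) ⟩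
  suc (edges (gadget γ)) ℕ.+ edges (hub gs)
    ≡⟨ cong₂ ℕ._+_ (gadget-edges γ) (edges-hub gs) ⟩
  (cycles γ ℕ.+ order γ) ℕ.+ (cycleRank gs ℕ.+ size gs)
    ≡⟨ medial (cycles γ) (order γ) (cycleRank gs) (size gs) ⟩
  (cycles γ ℕ.+ cycleRank gs) ℕ.+ (order γ ℕ.+ size gs)
    ∎
  where
  open ≡-Reasoning
  shuffle : ∀ a b c → suc a ℕ.+ (b ℕ.+ c) ≡ suc b ℕ.+ (a ℕ.+ c)
  shuffle = ℕ-Solver.solve-∀
  medial : ∀ a b c d → (a ℕ.+ b) ℕ.+ (c ℕ.+ d) ≡ (a ℕ.+ c) ℕ.+ (b ℕ.+ d)
  medial = ℕ-Solver.solve-∀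

cyclomatic-hub : ∀ gs → cyclomaticConnected (graph (hub gs)) ≡ + cycleRank gs
cyclomatic-hub gs = begin
  + edgeCount (graph (hub gs)) - + suc (size gs) + 1ℤ
    ≡⟨ cong (λ e → + e - + suc (size gs) + 1ℤ) (trans (edgeCount-graph (hub gs)) (edges-hub gs)) ⟩
  + (cycleRank gs ℕ.+ size gs) - (1ℤ + + size gs) + 1ℤ
    ≡⟨ cong (λ e → e - (1ℤ + + size gs) + 1ℤ) (ℤ.pos-+ (cycleRank gs) (size gs)) ⟩
  + cycleRank gs + + size gs - (1ℤ + + size gs) + 1ℤ
    ≡⟨ cancel (+ cycleRank gs) (+ size gs) ⟩
  + cycleRank gs
    ∎
  where
  open ≡-Reasoning
  cancel : ∀ c s → c + s - (1ℤ + s) + 1ℤ ≡ c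
  cancel = solve-∀

reach-root : ∀ gs (i : Fin (size gs)) →
  Σ (Fin (size gs)) λ j → mem j (roots true gs) ≡ true × Walk (graph (body gs)) i j
reach-root (triangle ∷ gs) zero                = zero , refl , here
reach-root (triangle ∷ gs) (suc zero)          = zero , refl , step refl here
reach-root (triangle ∷ gs) (suc (suc zero))    = zero , refl , step refl here
reach-root (triangle ∷ gs) (suc (suc (suc i))) with reach-root gs i
... | j , j-root , walk = suc (suc (suc j)) , j-root , liftʷ (liftʷ (liftʷ walk))
reach-root (square ∷ gs) zero                       = zero , refl , here
reach-root (square ∷ gs) (suc zero)                 = zero , refl , step refl here
reach-root (square ∷ gs) (suc (suc zero))           = zero , refl , step {v = suc zero} refl (step refl here)
reach-root (square ∷ gs) (suc (suc (suc zero)))     = zero , refl , step refl here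
reach-root (square ∷ gs) (suc (suc (suc (suc i)))) with reach-root gs i
... | j , j-root , walk = suc (suc (suc (suc j))) , j-root , liftʷ (liftʷ (liftʷ (liftʷ walk)))
reach-root (pendant ∷ gs) zero             = zero , refl , here
reach-root (pendant ∷ gs) (suc zero)       = zero , refl , step refl here
reach-root (pendant ∷ gs) (suc (suc i)) with reach-root gs i
... | j , j-root , walk = suc (suc j) , j-root , liftʷ (liftʷ walk)

reach-hub : ∀ gs (u : Fin (suc (size gs))) → Walk (graph (hub gs)) u zero
reach-hub gs zero    = here
reach-hub gs (suc i) with reach-root gs i
... | j , j-root , walk = liftʷ walk ++ʷ step j-root here

hub-connected : ∀ gs → Connected (graph (hub gs))
hub-connected gs = s≤s z≤n , λ u v → reach-hub gs u ++ʷ reverseʷ (reach-hub gs v)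

trianglesAndSquares : ℕ → ℕ → List Gadget
trianglesAndSquares q r = replicate q triangle ++ replicate r square

cycleRank-trianglesAndSquares : ∀ q r → cycleRank (trianglesAndSquares q r) ≡ q ℕ.+ r
cycleRank-trianglesAndSquares zero    zero    = refl
cycleRank-trianglesAndSquares zero    (suc r) = cong suc (cycleRank-trianglesAndSquares zero r)
cycleRank-trianglesAndSquares (suc q) r       = cong suc (cycleRank-trianglesAndSquares q r)

∏-trianglesAndSquares : ∀ q r (h : Gadget → ℤ) →
  ∏ (trianglesAndSquares q r) h ≡ h triangle ℤ.^ q * h square ℤ.^ r
∏-trianglesAndSquares q r h =
  trans (∏-++ (replicate q triangle) (replicate r square) h)
        (cong₂ _*_ (∏-replicate q triangle h) (∏-replicate r square h))

-1^k*i≡±i : ∀ k (i : ℤ) → -1ℤ ℤ.^ k * i ≡ i ⊎ -1ℤ ℤ.^ k * i ≡ - i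
-1^k*i≡±i zero    i = inj₁ (ℤ.*-identityˡ i)
-1^k*i≡±i (suc k) i =
  Sum.swap (Sum.map (λ eq → trans negate (cong -_ eq))
                    (λ eq → trans negate (trans (cong -_ eq) (ℤ.neg-involutive i)))
                    (-1^k*i≡±i k i))
  where
  negate : -1ℤ ℤ.^ suc k * i ≡ - (-1ℤ ℤ.^ k * i)
  negate = trans (ℤ.*-assoc -1ℤ (-1ℤ ℤ.^ k) i) (ℤ.-1*i≡-i _)

-2^q≡-1^q*2^q : ∀ q → (- (+ 2)) ℤ.^ q ≡ -1ℤ ℤ.^ q * + (2 ^ q)
-2^q≡-1^q*2^q zero    = refl
-2^q≡-1^q*2^q (suc q) = begin
  - (+ 2) * (- (+ 2)) ℤ.^ q                  ≡⟨ cong (- (+ 2) *_) (-2^q≡-1^q*2^q q) ⟩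
  - (+ 2) * (-1ℤ ℤ.^ q * + (2 ^ q))           ≡⟨ regroup (-1ℤ ℤ.^ q) (+ (2 ^ q)) ⟩
  -1ℤ * -1ℤ ℤ.^ q * (+ 2 * + (2 ^ q))         ≡⟨ cong (-1ℤ * -1ℤ ℤ.^ q *_) (≡-sym (ℤ.pos-* 2 (2 ^ q))) ⟩
  -1ℤ * -1ℤ ℤ.^ q * + (2 ℕ.* 2 ^ q)           ∎
  where
  open ≡-Reasoning
  regroup : ∀ a t → - (+ 2) * (a * t) ≡ -1ℤ * a * (+ 2 * t)
  regroup = solve-∀

module _ (q r : ℕ) where

  private
    gs : List Gadget
    gs = trianglesAndSquares q r
    a b : ℤ
    a = -1ℤ ℤ.^ q
    b = -1ℤ ℤ.^ r

  ∏-roots-kept : ∏ gs (λ γ → indep -1ℤ (gadget γ) (root false γ)) ≡ a * + (2 ^ q) * b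
  ∏-roots-kept = trans (∏-trianglesAndSquares q r _) (cong (_* b) (-2^q≡-1^q*2^q q))

  ∏-roots-deleted : ∏ gs (λ γ → indep -1ℤ (gadget γ) (root true γ)) ≡ a * b
  ∏-roots-deleted = ∏-trianglesAndSquares q r _

  indepPoly-hub-trianglesAndSquares :
    indepPoly (graph (hub gs)) -1ℤ ≡ -1ℤ ℤ.^ (q ℕ.+ r) * + (2 ^ q ∸ 1)
  indepPoly-hub-trianglesAndSquares = begin
    indepPoly (graph (hub gs)) -1ℤ
      ≡⟨ indepPoly-hub -1ℤ gs ⟩
    ∏ gs (λ γ → indep -1ℤ (gadget γ) (root false γ))
      + -1ℤ * ∏ gs (λ γ → indep -1ℤ (gadget γ) (root true γ))
      ≡⟨ cong₂ (λ k d → k + -1ℤ * d) ∏-roots-kept ∏-roots-deleted ⟩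
    a * + (2 ^ q) * b + -1ℤ * (a * b)
      ≡⟨ factor a b (+ (2 ^ q)) ⟩
    a * b * (+ (2 ^ q) - 1ℤ)
      ≡⟨ cong₂ _*_ (≡-sym (ℤ.^-distribˡ-+-* -1ℤ q r))
                   (trans (ℤ.m-n≡m⊖n (2 ^ q) 1) (ℤ.⊖-≥ (ℕ.m^n>0 2 q))) ⟩
    -1ℤ ℤ.^ (q ℕ.+ r) * + (2 ^ q ∸ 1)
      ∎
    where
    open ≡-Reasoning
    factor : ∀ a b t → a * t * b + -1ℤ * (a * b) ≡ a * b * (t - 1ℤ)
    factor = solve-∀

  indepPoly-hub-pendant-trianglesAndSquares :
    indepPoly (graph (hub (pendant ∷ gs))) -1ℤ ≡ -1ℤ ℤ.^ suc (q ℕ.+ r) * + (2 ^ q)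
  indepPoly-hub-pendant-trianglesAndSquares = begin
    indepPoly (graph (hub (pendant ∷ gs))) -1ℤ
      ≡⟨ indepPoly-hub -1ℤ (pendant ∷ gs) ⟩
    -1ℤ * ∏ gs (λ γ → indep -1ℤ (gadget γ) (root false γ))
      + -1ℤ * (0ℤ * ∏ gs (λ γ → indep -1ℤ (gadget γ) (root true γ)))
      ≡⟨ cong₂ (λ k d → -1ℤ * k + -1ℤ * (0ℤ * d)) ∏-roots-kept ∏-roots-deleted ⟩
    -1ℤ * (a * + (2 ^ q) * b) + -1ℤ * (0ℤ * (a * b))
      ≡⟨ factor a b (+ (2 ^ q)) ⟩
    -1ℤ * (a * b) * + (2 ^ q)
      ≡⟨ cong (λ s → -1ℤ * s * + (2 ^ q)) (≡-sym (ℤ.^-distribˡ-+-* -1ℤ q r)) ⟩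
    -1ℤ ℤ.^ suc (q ℕ.+ r) * + (2 ^ q)
      ∎
    where
    open ≡-Reasoning
    factor : ∀ a b t → -1ℤ * (a * t * b) + -1ℤ * (0ℤ * (a * b)) ≡ -1ℤ * (a * b) * t
    factor = solve-∀

lemma3p5 : (ν : ℕ) → 1 ≤ ν → (q : ℕ) → q ≤ ν →
    (Σ ℕ λ n → Σ (Graph n) λ G₁ → Connected G₁ × cyclomaticConnected G₁ ≡ + ν
        × (indepPoly G₁ (- (+ 1)) ≡ + (2 ^ q) ⊎ indepPoly G₁ (- (+ 1)) ≡ - (+ (2 ^ q))))
    × (Σ ℕ λ m → Σ (Graph m) λ G₂ → Connected G₂ × cyclomaticConnected G₂ ≡ + ν
        × (indepPoly G₂ (- (+ 1)) ≡ + (2 ^ q ∸ 1) ⊎ indepPoly G₂ (- (+ 1)) ≡ - (+ (2 ^ q ∸ 1))))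
lemma3p5 ν _ q q≤ν =
  ( _ , graph (hub (pendant ∷ gs)) , hub-connected (pendant ∷ gs) , trans (cyclomatic-hub (pendant ∷ gs)) rank
  , Sum.map (trans value₁) (trans value₁) (-1^k*i≡±i (suc (q ℕ.+ r)) (+ (2 ^ q))) )
  , ( _ , graph (hub gs) , hub-connected gs , trans (cyclomatic-hub gs) rank
  , Sum.map (trans value₂) (trans value₂) (-1^k*i≡±i (q ℕ.+ r) (+ (2 ^ q ∸ 1))) )
  where
  r : ℕ
  r = ν ∸ q
  gs : List Gadget
  gs = trianglesAndSquares q r
  rank : + cycleRank gs ≡ + ν
  rank = cong +_ (trans (cycleRank-trianglesAndSquares q r) (ℕ.m+[n∸m]≡n q≤ν))
  value₁ : indepPoly (graph (hub (pendant ∷ gs))) -1ℤ ≡ -1ℤ ℤ.^ suc (q ℕ.+ r) * + (2 ^ q)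
  value₁ = indepPoly-hub-pendant-trianglesAndSquares q r
  value₂ : indepPoly (graph (hub gs)) -1ℤ ≡ -1ℤ ℤ.^ (q ℕ.+ r) * + (2 ^ q ∸ 1)
  value₂ = indepPoly-hub-trianglesAndSquares q r
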